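{- There is an absolute constant $c>0$ such that for every $N$ there exist a finite convex set $A\subset\mathbb{R}$ with $|A|\ge N$ and an element $x\in A$ such that $x$ is the centre of at least $c|A|^{2/3}$ three-term arithmetic progressions in $A$, i.e. $|\{(b,d)\in A^2: b+d=2x\}|\geq c|A|^{2/3}$.
   Context: A convex set is a finite set $A=\{a_1<\cdots<a_n\}\subset\mathbb{R}$ whose consecutive differences $a_{i+1}-a_i$ form a strictly increasing sequence. -}

module Defs where

open import Data.Nat using (ℕ)
open import Data.Integer using (ℤ; _+_; _-_; _*_; _<_; _≟_; +_)
open import Data.List using (List; []; _∷_; length; filter; cartesianProduct)
open import Data.List.Relation.Unary.Linked using (Linked)
open import Data.Product using (_×_; _,_; proj₁; proj₂)

diffs : List ℤ → List ℤ
diffs (x ∷ y ∷ r) = (y - x) ∷ diffs (y ∷ r)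
diffs _ = []

-- A finite convex set {a_1 < ... < a_n}, listed in increasing order:
-- elements strictly increasing, consecutive differences strictly increasing.
Convex : List ℤ → Set
Convex A = Linked _<_ A × Linked _<_ (diffs A)

apCount : List ℤ → ℤ → ℕ
apCount A x = length (filter (λ p → (proj₁ p + proj₂ p) ≟ (+ 2) * x) (cartesianProduct A A))

-- Fix B and a common multiple Z ≥ B³ of 1, …, B. A direction r < s with r + s ≤ B, scaled by
-- Y = Z / (r + s), yields two blocks of gaps with the same sum 2rsY: s gaps of step 2 around 2rY
-- and r gaps of step 2 around 2sY. When s/r increases, sY increases and rY decreases, by at
-- least B because Z ≥ B³. So nesting the blocks around 0, the 2rY-blocks on the left and the
-- 2sY-blocks on the right, steeper directions further out, gives increasing gaps, i.e. a convex
-- set A, whose block boundaries are symmetric about 0: every direction gives a progression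
-- centred at 0. Taking s/r = 1 + p/d for the reduced fractions p/d with p, d ≤ M and B = 3M gives
-- at least M²/3 directions (as Σ_{d ≥ 2} 1/d² < 2/3) and |A| ≤ 1 + 3M · #directions, whence
-- |A|² ≤ 48 · #directions³.

module Submission where

open import Defs
open import Data.Nat using (ℕ; zero; suc; _+_; _*_; _∸_; _^_; _≤_; _<_; z≤n; s≤s; >-nonZero; _!)
import Data.Nat.Properties as ℕₚ
open import Data.Nat.ListAction using (sum)
open import Data.Nat.ListAction.Properties using (sum-++)
open import Data.Nat.Divisibility using (_∣_; _∣?_; divides-refl; ∣⇒≤; ∣-trans; m∣m*n; m≤n⇒m!∣n!)
open import Data.Nat.DivMod using (_/_; m*[n/m]≡n)
open import Data.Nat.GCD using (gcd; gcd[m,n]∣m; gcd[m,n]∣n; gcd[m,n]≡0⇒m≡0)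
open import Data.Nat.Coprimality using (Coprime; coprime?; gcd≡1⇒coprime)
open import Data.Nat.Tactic.RingSolver using (solve-∀)
open import Data.Integer as ℤ using (ℤ; +_; -_; +<+)
import Data.Integer.Properties as ℤₚ
import Data.Integer.Tactic.RingSolver as ℤ-Solver
open import Data.Rational as ℚ using (ℚ; mkℚ; normalize; 0ℚ)
import Data.Rational.Properties as ℚₚ
open import Data.List using (List; []; _∷_; _++_; length; map; filter; cartesianProduct; applyUpTo)
import Data.List.Properties as Listₚ
open import Data.List.Relation.Unary.All as All using (All; []; _∷_)
import Data.List.Relation.Unary.All.Properties as Allₚ
open import Data.List.Relation.Unary.Any as Any using (here; there)
import Data.List.Relation.Unary.Any.Properties as Anyₚ
open import Data.List.Relation.Unary.AllPairs as AllPairs using (AllPairs; []; _∷_)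
import Data.List.Relation.Unary.AllPairs.Properties as AllPairsₚ
open import Data.List.Relation.Unary.Linked as Linked using (Linked; []; [-]; _∷_)
import Data.List.Relation.Unary.Linked.Properties as Linkedₚ
open import Data.List.Relation.Unary.Unique.Propositional using (Unique)
import Data.List.Relation.Unary.Unique.Propositional.Properties as Uniqueₚ
open import Data.List.Relation.Binary.Permutation.Propositional using (↭-sym; ↭⇒↭ₛ)
open import Data.List.Relation.Binary.Permutation.Propositional.Properties using (All-resp-↭; ↭-length)
import Data.List.Relation.Binary.Permutation.Setoid.Properties as Permutationₛ
open import Data.List.Membership.Propositional using (_∈_)
open import Data.List.Membership.Propositional.Properties
  using (∈-++⁺ʳ; ∈-filter⁻; ∈-cartesianProduct⁻; ∈-applyUpTo⁻)
open import Data.List.Membership.DecPropositional ℤ._≟_ using (_∈?_)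
open import Data.Product using (_×_; _,_; proj₁; proj₂; ∃-syntax)
open import Data.Sum using (_⊎_; inj₁; inj₂)
open import Data.Empty using (⊥-elim)
open import Relation.Nullary using (yes; no; ¬_)
open import Relation.Nullary.Decidable using (_×-dec_)
import Relation.Unary
import Relation.Binary.Construct.On as On
open import Relation.Binary.Definitions using (tri<; tri≈; tri>)
open import Relation.Binary.PropositionalEquality
open ℕₚ.≤-Reasoning

length-filter-++ : ∀ {A : Set} {P : A → Set} (P? : Relation.Unary.Decidable P) xs ys →
                   length (filter P? (xs ++ ys)) ≡ length (filter P? xs) + length (filter P? ys)
length-filter-++ P? xs ys = trans (cong length (Listₚ.filter-++ P? xs ys)) (Listₚ.length-++ (filter P? xs))

AllPairs-map-under : ∀ {A : Set} {P : A → Set} {R S : A → A → Set} {xs} →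
                     (∀ {x y} → P x → P y → R x y → S x y) → All P xs → AllPairs R xs → AllPairs S xs
AllPairs-map-under f []         []           = []
AllPairs-map-under f (px ∷ pxs) (Rxs ∷ Rxss) =
  All.zipWith (λ (py , Rxy) → f px py Rxy) (pxs , Rxs) ∷ AllPairs-map-under f pxs Rxss

-- Convex sets from increasing gaps

points : ℤ → List ℕ → List ℤ
points a []      = a ∷ []
points a (g ∷ G) = a ∷ points (a ℤ.+ + g) G

starts : ℤ → List ℕ → List ℤ
starts a []      = []
starts a (g ∷ G) = a ∷ starts (a ℤ.+ + g) G

length-points : ∀ a G → length (points a G) ≡ suc (length G)
length-points a []      = refl
length-points a (g ∷ G) = cong suc (length-points (a ℤ.+ + g) G)

+-sum-∷ : ∀ a g G → a ℤ.+ + g ℤ.+ + sum G ≡ a ℤ.+ + sum (g ∷ G)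
+-sum-∷ a g G = trans (ℤₚ.+-assoc a (+ g) (+ sum G)) (cong (ℤ._+_ a) (sym (ℤₚ.pos-+ g (sum G))))

points-++ : ∀ a G H → points a (G ++ H) ≡ starts a G ++ points (a ℤ.+ + sum G) H
points-++ a []      H = cong (λ b → points b H) (sym (ℤₚ.+-identityʳ a))
points-++ a (g ∷ G) H =
  cong (a ∷_) (trans (points-++ (a ℤ.+ + g) G H) (cong (λ b → starts _ G ++ points b H) (+-sum-∷ a g G)))

starts-++ : ∀ a G H → starts a (G ++ H) ≡ starts a G ++ starts (a ℤ.+ + sum G) H
starts-++ a []      H = cong (λ b → starts b H) (sym (ℤₚ.+-identityʳ a))
starts-++ a (g ∷ G) H =
  cong (a ∷_) (trans (starts-++ (a ℤ.+ + g) G H) (cong (λ b → starts _ G ++ starts b H) (+-sum-∷ a g G)))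

a+b-a≡b : ∀ a b → a ℤ.+ b ℤ.- a ≡ b
a+b-a≡b = ℤ-Solver.solve-∀

a<a+g : ∀ a {g} → 0 < g → a ℤ.< a ℤ.+ + g
a<a+g a 0<g = subst (ℤ._< a ℤ.+ + _) (ℤₚ.+-identityʳ a) (ℤₚ.+-monoʳ-< a (+<+ 0<g))

diffs-points : ∀ a G → diffs (points a G) ≡ map +_ G
diffs-points a []          = refl
diffs-points a (g ∷ [])    = cong (_∷ []) (a+b-a≡b a (+ g))
diffs-points a (g ∷ h ∷ G) = cong₂ _∷_ (a+b-a≡b a (+ g)) (diffs-points (a ℤ.+ + g) (h ∷ G))

points-increasing : ∀ a {G} → All (0 <_) G → Linked ℤ._<_ (points a G)
points-increasing a []               = [-]
points-increasing a (0<g ∷ [])       = a<a+g a 0<g ∷ [-]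
points-increasing a (0<g ∷ 0<h ∷ G>0) = a<a+g a 0<g ∷ points-increasing _ (0<h ∷ G>0)

points-convex : ∀ a {G} → All (0 <_) G → Linked _<_ G → Convex (points a G)
points-convex a {G} G>0 G↗ =
  points-increasing a G>0 , subst (Linked ℤ._<_) (sym (diffs-points a G)) (Linkedₚ.map⁺ (Linked.map +<+ G↗))

-- Progressions centred at 0

mirrors : List ℤ → List ℤ → ℕ
mirrors xs A = length (filter (λ x → (- x) ∈? A) xs)

mirrors-++ : ∀ xs ys A → mirrors (xs ++ ys) A ≡ mirrors xs A + mirrors ys A
mirrors-++ xs ys A = length-filter-++ (λ x → (- x) ∈? A) xs ys

zeroSums : List (ℤ × ℤ) → ℕ
zeroSums ps = length (filter (λ p → proj₁ p ℤ.+ proj₂ p ℤ.≟ + 0) ps)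

mirrors-≤-zeroSums : ∀ xs A → mirrors xs A ≤ zeroSums (cartesianProduct xs A)
mirrors-≤-zeroSums []       A = z≤n
mirrors-≤-zeroSums (x ∷ xs) A = begin
  mirrors (x ∷ xs) A                                      ≤⟨ head-step ⟩
  zeroSums (map (x ,_) A) + zeroSums (cartesianProduct xs A) ≡⟨ length-filter-++ _ (map (x ,_) A) _ ⟨
  zeroSums (cartesianProduct (x ∷ xs) A)                  ∎
  where
  sums-to-0 : ∀ {y} → - x ≡ y → x ℤ.+ y ≡ + 0
  sums-to-0 refl = ℤₚ.+-inverseʳ x
  head-step : mirrors (x ∷ xs) A ≤ zeroSums (map (x ,_) A) + zeroSums (cartesianProduct xs A)
  head-step with (- x) ∈? A
  ... | yes -x∈A = ℕₚ.+-mono-≤ (Listₚ.filter-some _ (Anyₚ.map⁺ (Any.map sums-to-0 -x∈A)))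
                               (mirrors-≤-zeroSums xs A)
  ... | no  _     = ℕₚ.≤-trans (mirrors-≤-zeroSums xs A) (ℕₚ.m≤n+m _ _)

mirrors-≤-apCount : ∀ A → mirrors A A ≤ apCount A (+ 0)
mirrors-≤-apCount A = mirrors-≤-zeroSums A A

-- Nested blocks with equal sums

BlockPair : Set
BlockPair = List ℕ × List ℕ

-- Pairs are listed innermost first, and `nested` places 0 between the left and the right gaps.
leftGaps rightGaps : List BlockPair → List ℕ
leftGaps []             = []
leftGaps ((ℓ , ρ) ∷ bs) = leftGaps bs ++ ℓ
rightGaps []             = []
rightGaps ((ℓ , ρ) ∷ bs) = ρ ++ rightGaps bs

nested : List BlockPair → List ℤ
nested bs = points (- + sum (leftGaps bs)) (leftGaps bs ++ rightGaps bs)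

Balanced : BlockPair → Set
Balanced (ℓ , ρ) = 0 < length ℓ × sum ℓ ≡ sum ρ

head∈points : ∀ a G → a ∈ points a G
head∈points a []      = here refl
head∈points a (g ∷ G) = here refl

nested-split : ∀ bs → nested bs ≡ starts (- + sum (leftGaps bs)) (leftGaps bs) ++ points (+ 0) (rightGaps bs)
nested-split bs = trans (points-++ _ (leftGaps bs) (rightGaps bs))
  (cong (λ a → starts (- + sum (leftGaps bs)) (leftGaps bs) ++ points a (rightGaps bs))
        (ℤₚ.+-inverseˡ (+ sum (leftGaps bs))))

0∈nested : ∀ bs → + 0 ∈ nested bs
0∈nested bs = subst (+ 0 ∈_) (sym (nested-split bs)) (∈-++⁺ʳ _ (head∈points (+ 0) (rightGaps bs)))

-- The innermost left block starts at −σ′ where the innermost right block ends at σ′,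
-- as the two blocks have the same sum.
left-mirrors : ∀ σ bs A → All Balanced bs → (∀ {x} → x ∈ points σ (rightGaps bs) → x ∈ A) →
               length bs ≤ mirrors (starts (- (σ ℤ.+ + sum (leftGaps bs))) (leftGaps bs)) A
left-mirrors σ []                    A _ _ = z≤n
left-mirrors σ (([] , ρ) ∷ bs)        A ((() , _) ∷ _)
left-mirrors σ ((ℓ@(g ∷ _) , ρ) ∷ bs) A ((_ , Σℓ≡Σρ) ∷ bal) R⊆A = begin
  suc (length bs)                                        ≡⟨ ℕₚ.+-comm 1 (length bs) ⟩
  length bs + 1                                          ≤⟨ ℕₚ.+-mono-≤ (left-mirrors σ′ bs A bal inner⊆A) head-mirrored ⟩
  mirrors (starts a′ L) A + mirrors (starts (- σ′) ℓ) A  ≡⟨ mirrors-++ (starts a′ L) _ A ⟨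
  mirrors (starts a′ L ++ starts (- σ′) ℓ) A             ≡⟨ cong (λ xs → mirrors xs A) starts-split ⟨
  mirrors (starts a (L ++ ℓ)) A                          ∎
  where
  L : List ℕ
  L = leftGaps bs
  σ′ a a′ : ℤ
  σ′ = σ ℤ.+ + sum ρ
  a  = - (σ ℤ.+ + sum (L ++ ℓ))
  a′ = - (σ′ ℤ.+ + sum L)
  right-split : points σ (ρ ++ rightGaps bs) ≡ starts σ ρ ++ points σ′ (rightGaps bs)
  right-split = points-++ σ ρ (rightGaps bs)
  inner⊆A : ∀ {x} → x ∈ points σ′ (rightGaps bs) → x ∈ A
  inner⊆A x∈ = R⊆A (subst (_ ∈_) (sym right-split) (∈-++⁺ʳ _ x∈))
  head-mirrored : 1 ≤ mirrors (starts (- σ′) ℓ) A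
  head-mirrored = Listₚ.filter-some (λ x → (- x) ∈? A)
    (here (subst (_∈ A) (sym (ℤₚ.neg-involutive σ′)) (inner⊆A (head∈points σ′ (rightGaps bs)))))
  starts-split : starts a (L ++ ℓ) ≡ starts a′ L ++ starts (- σ′) ℓ
  starts-split = trans (starts-++ a L ℓ) (cong₂ (λ b c → starts b L ++ starts c ℓ) offset
                                          (trans (cong (ℤ._+ + sum L) offset) (cancel σ′ (+ sum L))))
    where
    reassoc : ∀ s u v → - (s ℤ.+ (u ℤ.+ v)) ≡ - ((s ℤ.+ v) ℤ.+ u)
    reassoc = ℤ-Solver.solve-∀
    cancel : ∀ s u → - (s ℤ.+ u) ℤ.+ u ≡ - s
    cancel = ℤ-Solver.solve-∀
    offset : a ≡ a′
    offset = trans (cong (λ n → - (σ ℤ.+ + n)) (trans (sum-++ L ℓ) (cong (_+_ (sum L)) Σℓ≡Σρ)))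
                   (trans (cong (λ z → - (σ ℤ.+ z)) (ℤₚ.pos-+ (sum L) (sum ρ))) (reassoc σ (+ sum L) (+ sum ρ)))

nested-mirrors : ∀ bs → All Balanced bs → length bs ≤ mirrors (nested bs) (nested bs)
nested-mirrors bs balanced = begin
  length bs                 ≤⟨ left-mirrors (+ 0) bs A balanced R⊆A ⟩
  mirrors S A               ≤⟨ ℕₚ.m≤m+n _ _ ⟩
  mirrors S A + mirrors P A ≡⟨ mirrors-++ S P A ⟨
  mirrors (S ++ P) A        ≡⟨ cong (λ xs → mirrors xs A) (nested-split bs) ⟨
  mirrors A A               ∎
  where
  A S P : List ℤ
  A = nested bs
  S = starts (- + sum (leftGaps bs)) (leftGaps bs)
  P = points (+ 0) (rightGaps bs)
  R⊆A : ∀ {x} → x ∈ P → x ∈ A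
  R⊆A x∈P = subst (_ ∈_) (sym (nested-split bs)) (∈-++⁺ʳ S x∈P)

length-nested-≤ : ∀ n bs → All (λ b → length (proj₁ b) + length (proj₂ b) ≤ n) bs →
                  length (nested bs) ≤ suc (n * length bs)
length-nested-≤ n bs bounded = begin
  length (nested bs)                       ≡⟨ length-points _ (leftGaps bs ++ rightGaps bs) ⟩
  suc (length (leftGaps bs ++ rightGaps bs)) ≡⟨ cong suc (Listₚ.length-++ (leftGaps bs)) ⟩
  suc (length (leftGaps bs) + length (rightGaps bs)) ≤⟨ s≤s (gaps-≤ bs bounded) ⟩
  suc (n * length bs)                      ∎
  where
  gaps-≤ : ∀ bs → All (λ b → length (proj₁ b) + length (proj₂ b) ≤ n) bs →
           length (leftGaps bs) + length (rightGaps bs) ≤ n * length bs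
  gaps-≤ []             []             = z≤n
  gaps-≤ ((ℓ , ρ) ∷ bs) (ℓρ≤n ∷ bounded) = begin
    length (leftGaps bs ++ ℓ) + length (ρ ++ rightGaps bs)
      ≡⟨ cong₂ _+_ (Listₚ.length-++ (leftGaps bs)) (Listₚ.length-++ ρ) ⟩
    (length (leftGaps bs) + length ℓ) + (length ρ + length (rightGaps bs))
      ≡⟨ regroup (length (leftGaps bs)) (length ℓ) (length ρ) (length (rightGaps bs)) ⟩
    (length ℓ + length ρ) + (length (leftGaps bs) + length (rightGaps bs))
      ≤⟨ ℕₚ.+-mono-≤ ℓρ≤n (gaps-≤ bs bounded) ⟩
    n + n * length bs
      ≡⟨ ℕₚ.*-suc n (length bs) ⟨
    n * suc (length bs) ∎
    where
    regroup : ∀ a b c d → (a + b) + (c + d) ≡ (b + c) + (a + d)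
    regroup = solve-∀

_≪_ : List ℕ → List ℕ → Set
xs ≪ ys = All (λ x → All (x <_) ys) xs

Inside : BlockPair → BlockPair → Set
Inside (ℓ , ρ) (ℓ′ , ρ′) = ℓ′ ≪ ℓ × ρ ≪ ρ′

Straddles : ℕ → BlockPair → Set
Straddles t (ℓ , ρ) = All (0 <_) ℓ × AllPairs _<_ ℓ × AllPairs _<_ ρ × All (_< t) ℓ × All (t <_) ρ

All-leftGaps : ∀ {P : ℕ → Set} {bs} → All (λ b → All P (proj₁ b)) bs → All P (leftGaps bs)
All-leftGaps []          = []
All-leftGaps (Pℓ ∷ Pbs) = Allₚ.++⁺ (All-leftGaps Pbs) Pℓ

All-rightGaps : ∀ {P : ℕ → Set} {bs} → All (λ b → All P (proj₂ b)) bs → All P (rightGaps bs)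
All-rightGaps []          = []
All-rightGaps (Pρ ∷ Pbs) = Allₚ.++⁺ Pρ (All-rightGaps Pbs)

leftGaps-sorted : ∀ {t} bs → All (Straddles t) bs → AllPairs Inside bs → AllPairs _<_ (leftGaps bs)
leftGaps-sorted []             []                      []           = []
leftGaps-sorted ((ℓ , ρ) ∷ bs) ((_ , ℓ↗ , _) ∷ str) (ins ∷ inss) =
  AllPairsₚ.++⁺ (leftGaps-sorted bs str inss) ℓ↗ (All-leftGaps (All.map proj₁ ins))

rightGaps-sorted : ∀ {t} bs → All (Straddles t) bs → AllPairs Inside bs → AllPairs _<_ (rightGaps bs)
rightGaps-sorted []             []                          []           = []
rightGaps-sorted ((ℓ , ρ) ∷ bs) ((_ , _ , ρ↗ , _) ∷ str) (ins ∷ inss) =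
  AllPairsₚ.++⁺ ρ↗ (rightGaps-sorted bs str inss) (All.map All-rightGaps (Allₚ.All-swap (All.map proj₂ ins)))

nested-convex : ∀ t bs → All (Straddles t) bs → AllPairs Inside bs → Convex (nested bs)
nested-convex t bs str inss = points-convex _ (Allₚ.++⁺ L>0 (All.map (ℕₚ.≤-<-trans z≤n) R>t))
  (Linkedₚ.AllPairs⇒Linked (AllPairsₚ.++⁺ (leftGaps-sorted bs str inss) (rightGaps-sorted bs str inss)
    (All.map (λ x<t → All.map (ℕₚ.<-trans x<t) R>t) L<t)))
  where
  L>0 : All (0 <_) (leftGaps bs)
  L>0 = All-leftGaps (All.map proj₁ str)
  L<t : All (_< t) (leftGaps bs)
  L<t = All-leftGaps (All.map (λ (_ , _ , _ , ℓ<t , _) → ℓ<t) str)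
  R>t : All (t <_) (rightGaps bs)
  R>t = All-rightGaps (All.map (λ (_ , _ , _ , _ , ρ>t) → ρ>t) str)

-- Blocks of gaps with step 2

ap2 : ℕ → ℕ → List ℕ
ap2 a zero    = []
ap2 a (suc n) = a ∷ ap2 (2 + a) n

length-ap2 : ∀ a n → length (ap2 a n) ≡ n
length-ap2 a zero    = refl
length-ap2 a (suc n) = cong suc (length-ap2 (2 + a) n)

sum-ap2 : ∀ a n → sum (ap2 a n) + n ≡ n * (a + n)
sum-ap2 a zero    = refl
sum-ap2 a (suc n) = begin-equality
  a + sum (ap2 (2 + a) n) + suc n ≡⟨ shift a (sum (ap2 (2 + a) n)) n ⟩
  a + (sum (ap2 (2 + a) n) + n) + 1 ≡⟨ cong (λ m → a + m + 1) (sum-ap2 (2 + a) n) ⟩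
  a + n * (2 + a + n) + 1         ≡⟨ close a n ⟩
  suc n * (a + suc n)             ∎
  where
  shift : ∀ a s n → a + s + suc n ≡ a + (s + n) + 1
  shift = solve-∀
  close : ∀ a n → a + n * (2 + a + n) + 1 ≡ suc n * (a + suc n)
  close = solve-∀

ap2-sorted : ∀ a n → AllPairs _<_ (ap2 a n)
ap2-sorted a n = Linkedₚ.Linked⇒AllPairs ℕₚ.<-trans (linked a n)
  where
  linked : ∀ a n → Linked _<_ (ap2 a n)
  linked a zero          = []
  linked a (suc zero)    = [-]
  linked a (suc (suc n)) = ℕₚ.m<n+m a (s≤s z≤n) ∷ linked (2 + a) (suc n)

ap2-bounds : ∀ a n → All (λ x → a ≤ x × 2 + x ≤ a + 2 * n) (ap2 a n)
ap2-bounds a zero    = []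
ap2-bounds a (suc n) = (ℕₚ.≤-refl , head-bound) ∷ All.map shift (ap2-bounds (2 + a) n)
  where
  grow : ∀ a n → 2 + a + 2 * n ≡ a + 2 * suc n
  grow = solve-∀
  head-bound : 2 + a ≤ a + 2 * suc n
  head-bound = subst (2 + a ≤_) (grow a n) (ℕₚ.m≤m+n (2 + a) (2 * n))
  shift : ∀ {x} → 2 + a ≤ x × 2 + x ≤ 2 + a + 2 * n → a ≤ x × 2 + x ≤ a + 2 * suc n
  shift {x} (lo , hi) = ℕₚ.≤-trans (ℕₚ.m≤n+m a 2) lo , subst (2 + x ≤_) (grow a n) hi

-- c − n + 1, c − n + 3, …, c + n − 1, provided n ≤ c
block : ℕ → ℕ → List ℕ
block c n = ap2 (suc c ∸ n) n

Near : ℕ → ℕ → ℕ → Set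
Near c n x = c < x + n × x < c + n

module _ {c n : ℕ} (n≤c : n ≤ c) where

  private
    start+n : suc c ∸ n + n ≡ suc c
    start+n = ℕₚ.m∸n+n≡m (ℕₚ.m≤n⇒m≤1+n n≤c)

  sum-block : sum (block c n) ≡ n * c
  sum-block = ℕₚ.+-cancelʳ-≡ n _ _ (begin-equality
    sum (block c n) + n        ≡⟨ sum-ap2 (suc c ∸ n) n ⟩
    n * (suc c ∸ n + n)        ≡⟨ cong (n *_) start+n ⟩
    n * suc c                  ≡⟨ ℕₚ.*-suc n c ⟩
    n + n * c                  ≡⟨ ℕₚ.+-comm n (n * c) ⟩
    n * c + n                  ∎)

  block-near : All (Near c n) (block c n)
  block-near = All.map near (ap2-bounds (suc c ∸ n) n)
    where
    near : ∀ {x} → suc c ∸ n ≤ x × 2 + x ≤ suc c ∸ n + 2 * n → Near c n x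
    near {x} (lo , hi) = subst (_≤ x + n) start+n (ℕₚ.+-monoˡ-≤ n lo) , ℕₚ.≤-pred (begin
      2 + x                  ≤⟨ hi ⟩
      suc c ∸ n + 2 * n      ≡⟨ regroup (suc c ∸ n) n ⟩
      (suc c ∸ n + n) + n    ≡⟨ cong (_+ n) start+n ⟩
      suc (c + n)            ∎)
      where
      regroup : ∀ a n → a + 2 * n ≡ (a + n) + n
      regroup = solve-∀

  block-positive : All (0 <_) (block c n)
  block-positive = All.map (λ (c<x+n , _) → ℕₚ.+-cancelʳ-< n 0 _ (ℕₚ.≤-<-trans n≤c c<x+n)) block-near

  block-below : ∀ {t} → c + n ≤ t → All (_< t) (block c n)
  block-below c+n≤t = All.map (λ (_ , x<c+n) → ℕₚ.<-≤-trans x<c+n c+n≤t) block-near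

  block-above : ∀ {t} → t + n ≤ c → All (t <_) (block c n)
  block-above t+n≤c = All.map (λ (c<x+n , _) → ℕₚ.+-cancelʳ-< n _ _ (ℕₚ.≤-<-trans t+n≤c c<x+n)) block-near

block-≪ : ∀ {c n c′ n′} → n ≤ c → n′ ≤ c′ → c + n + n′ ≤ c′ → block c n ≪ block c′ n′
block-≪ n≤c n′≤c′ gap =
  All.map (λ x<t → All.map (ℕₚ.<-trans x<t) (block-above n′≤c′ gap)) (block-below n≤c ℕₚ.≤-refl)

-- Directions

*-cancelˡ-≤-pos : ∀ {k m n} → 0 < k → k * m ≤ k * n → m ≤ n
*-cancelˡ-≤-pos {suc k} _ = ℕₚ.*-cancelˡ-≤ (suc k)

scaled-gap : ∀ {a a′ w w′ Y Y′ B Z} → 0 < w → 0 < w′ → w * Y ≡ Z → w′ * Y′ ≡ Z →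
             w * w′ * B ≤ Z → a * w′ < a′ * w → a * Y + B ≤ a′ * Y′
scaled-gap {a} {a′} {w} {w′} {Y} {Y′} {B} {Z} w>0 w′>0 wY≡Z w′Y′≡Z ww′B≤Z aw′<a′w =
  *-cancelˡ-≤-pos (ℕₚ.*-mono-< w>0 w′>0) (begin
    w * w′ * (a * Y + B)          ≡⟨ expand w w′ a Y B ⟩
    a * w′ * (w * Y) + w * w′ * B ≡⟨ cong (λ z → a * w′ * z + w * w′ * B) wY≡Z ⟩
    a * w′ * Z + w * w′ * B       ≤⟨ ℕₚ.+-monoʳ-≤ (a * w′ * Z) ww′B≤Z ⟩
    a * w′ * Z + Z                ≡⟨ ℕₚ.+-comm (a * w′ * Z) Z ⟩
    suc (a * w′) * Z              ≤⟨ ℕₚ.*-monoˡ-≤ Z aw′<a′w ⟩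
    a′ * w * Z                    ≡⟨ cong (a′ * w *_) w′Y′≡Z ⟨
    a′ * w * (w′ * Y′)            ≡⟨ collect w w′ a′ Y′ ⟩
    w * w′ * (a′ * Y′)            ∎)
  where
  expand : ∀ w w′ a Y B → w * w′ * (a * Y + B) ≡ a * w′ * (w * Y) + w * w′ * B
  expand = solve-∀
  collect : ∀ w w′ a′ Y′ → a′ * w * (w′ * Y′) ≡ w * w′ * (a′ * Y′)
  collect = solve-∀

double-gap : ∀ {P P′ B n n′} → P + B ≤ P′ → n ≤ B → n′ ≤ B → 2 * P + n + n′ ≤ 2 * P′
double-gap {P} {P′} {B} {n} {n′} P+B≤P′ n≤B n′≤B = begin
  2 * P + n + n′ ≤⟨ ℕₚ.+-mono-≤ (ℕₚ.+-monoʳ-≤ (2 * P) n≤B) n′≤B ⟩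
  2 * P + B + B  ≡⟨ twice P B ⟩
  2 * (P + B)    ≤⟨ ℕₚ.*-monoʳ-≤ 2 P+B≤P′ ⟩
  2 * P′         ∎
  where
  twice : ∀ P B → 2 * P + B + B ≡ 2 * (P + B)
  twice = solve-∀

Direction : Set
Direction = ℕ × ℕ × ℕ

Steeper : Direction → Direction → Set
Steeper (s , r , _) (s′ , r′ , _) = s * r′ < s′ * r

blocks : Direction → BlockPair
blocks (s , r , Y) = block (2 * (r * Y)) s , block (2 * (s * Y)) r

module Directions (B Z : ℕ) (B³≤Z : B * B * B ≤ Z) where

  Good : Direction → Set
  Good (s , r , Y) = 1 ≤ r × r < s × r + s ≤ B × (r + s) * Y ≡ Z

  private
    weight-pos : ∀ {s r} → 1 ≤ r → 0 < r + s
    weight-pos 1≤r = ℕₚ.≤-trans 1≤r (ℕₚ.m≤m+n _ _)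

  scale-≥ : ∀ {s r Y} → Good (s , r , Y) → B ≤ Y
  scale-≥ {s} {r} {Y} (1≤r , _ , w≤B , wY≡Z) = *-cancelˡ-≤-pos (weight-pos 1≤r) (begin
    (r + s) * B ≤⟨ ℕₚ.*-monoˡ-≤ B w≤B ⟩
    B * B       ≤⟨ ℕₚ.m≤m*n (B * B) B {{>-nonZero (ℕₚ.<-≤-trans (weight-pos 1≤r) w≤B)}} ⟩
    B * B * B   ≤⟨ B³≤Z ⟩
    Z           ≡⟨ wY≡Z ⟨
    (r + s) * Y ∎)

  private
    ≤-double-scaled : ∀ {n k Y} → n ≤ Y → 1 ≤ k → n ≤ 2 * (k * Y)
    ≤-double-scaled {n} {k} {Y} n≤Y 1≤k = begin
      n           ≤⟨ n≤Y ⟩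
      Y           ≤⟨ ℕₚ.m≤n*m Y k {{>-nonZero 1≤k}} ⟩
      k * Y       ≤⟨ ℕₚ.m≤n*m (k * Y) 2 ⟩
      2 * (k * Y) ∎

  module _ {s r Y : ℕ} (good : Good (s , r , Y)) where

    private
      1≤r : 1 ≤ r
      1≤r = proj₁ good
      r<s : r < s
      r<s = proj₁ (proj₂ good)
      wY≡Z : (r + s) * Y ≡ Z
      wY≡Z = proj₂ (proj₂ (proj₂ good))
      r≤B : r ≤ B
      r≤B = ℕₚ.m+n≤o⇒m≤o r (proj₁ (proj₂ (proj₂ good)))
      s≤B : s ≤ B
      s≤B = ℕₚ.m+n≤o⇒n≤o r (proj₁ (proj₂ (proj₂ good)))
      B≤Y : B ≤ Y
      B≤Y = scale-≥ good
      1≤s : 1 ≤ s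
      1≤s = ℕₚ.≤-trans 1≤r (ℕₚ.<⇒≤ r<s)

    left-fits : s ≤ 2 * (r * Y)
    left-fits = ≤-double-scaled (ℕₚ.≤-trans s≤B B≤Y) 1≤r

    right-fits : r ≤ 2 * (s * Y)
    right-fits = ≤-double-scaled (ℕₚ.≤-trans r≤B B≤Y) 1≤s

    left-below : 2 * (r * Y) + s ≤ Z
    left-below = begin
      2 * (r * Y) + s     ≤⟨ ℕₚ.+-monoʳ-≤ (2 * (r * Y)) (ℕₚ.≤-trans s≤B B≤Y) ⟩
      2 * (r * Y) + Y     ≡⟨ regroup r Y ⟩
      r * Y + suc r * Y   ≤⟨ ℕₚ.+-monoʳ-≤ (r * Y) (ℕₚ.*-monoˡ-≤ Y r<s) ⟩
      r * Y + s * Y       ≡⟨ ℕₚ.*-distribʳ-+ Y r s ⟨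
      (r + s) * Y         ≡⟨ wY≡Z ⟩
      Z                   ∎
      where
      regroup : ∀ r Y → 2 * (r * Y) + Y ≡ r * Y + suc r * Y
      regroup = solve-∀

    right-above : Z + r ≤ 2 * (s * Y)
    right-above = begin
      Z + r               ≡⟨ cong (_+ r) wY≡Z ⟨
      (r + s) * Y + r     ≤⟨ ℕₚ.+-monoʳ-≤ ((r + s) * Y) (ℕₚ.≤-trans r≤B B≤Y) ⟩
      (r + s) * Y + Y     ≡⟨ regroup r s Y ⟩
      suc r * Y + s * Y   ≤⟨ ℕₚ.+-monoˡ-≤ (s * Y) (ℕₚ.*-monoˡ-≤ Y r<s) ⟩
      s * Y + s * Y       ≡⟨ cong (_+_ (s * Y)) (ℕₚ.+-identityʳ (s * Y)) ⟨
      2 * (s * Y)         ∎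
      where
      regroup : ∀ r s Y → (r + s) * Y + Y ≡ suc r * Y + s * Y
      regroup = solve-∀

    blocks-balanced : Balanced (blocks (s , r , Y))
    blocks-balanced = subst (0 <_) (sym (length-ap2 _ s)) 1≤s , (begin-equality
      sum (block (2 * (r * Y)) s) ≡⟨ sum-block left-fits ⟩
      s * (2 * (r * Y))           ≡⟨ swap s r Y ⟩
      r * (2 * (s * Y))           ≡⟨ sum-block right-fits ⟨
      sum (block (2 * (s * Y)) r) ∎)
      where
      swap : ∀ s r Y → s * (2 * (r * Y)) ≡ r * (2 * (s * Y))
      swap = solve-∀

    blocks-straddle : Straddles Z (blocks (s , r , Y))
    blocks-straddle = block-positive left-fits , ap2-sorted _ s , ap2-sorted _ r ,
                      block-below left-fits left-below , block-above right-fits right-above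

    blocks-size : length (proj₁ (blocks (s , r , Y))) + length (proj₂ (blocks (s , r , Y))) ≤ B
    blocks-size = begin
      length (block (2 * (r * Y)) s) + length (block (2 * (s * Y)) r)
        ≡⟨ cong₂ _+_ (length-ap2 _ s) (length-ap2 _ r) ⟩
      s + r ≡⟨ ℕₚ.+-comm s r ⟩
      r + s ≤⟨ proj₁ (proj₂ (proj₂ good)) ⟩
      B     ∎

  private
    cross-+ : ∀ {a b a′ b′} → a * b′ < a′ * b → a * (b′ + a′) < a′ * (b + a)
    cross-+ {a} {b} {a′} {b′} ab′<a′b = begin-strict
      a * (b′ + a′)     ≡⟨ ℕₚ.*-distribˡ-+ a b′ a′ ⟩
      a * b′ + a * a′   <⟨ ℕₚ.+-monoˡ-< (a * a′) ab′<a′b ⟩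
      a′ * b + a * a′   ≡⟨ regroup a b a′ ⟩
      a′ * (b + a)      ∎
      where
      regroup : ∀ a b a′ → a′ * b + a * a′ ≡ a′ * (b + a)
      regroup = solve-∀

  blocks-inside : ∀ {d d′} → Good d → Good d′ → Steeper d d′ → Inside (blocks d) (blocks d′)
  blocks-inside {s , r , Y} {s′ , r′ , Y′} good@(1≤r , _ , w≤B , wY≡Z) good′@(1≤r′ , _ , w′≤B , w′Y′≡Z) sr′<s′r =
    block-≪ (left-fits good′) (left-fits good)
            (double-gap left-lower (ℕₚ.m+n≤o⇒n≤o r′ w′≤B) (ℕₚ.m+n≤o⇒n≤o r w≤B)) ,
    block-≪ (right-fits good) (right-fits good′)
            (double-gap right-higher (ℕₚ.m+n≤o⇒m≤o r w≤B) (ℕₚ.m+n≤o⇒m≤o r′ w′≤B))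
    where
    ww′B≤Z : ∀ {w w′} → w ≤ B → w′ ≤ B → w * w′ * B ≤ Z
    ww′B≤Z w≤B w′≤B = ℕₚ.≤-trans (ℕₚ.*-mono-≤ (ℕₚ.*-mono-≤ w≤B w′≤B) ℕₚ.≤-refl) B³≤Z
    right-higher : s * Y + B ≤ s′ * Y′
    right-higher = scaled-gap {a = s} {a′ = s′} (weight-pos 1≤r) (weight-pos 1≤r′) wY≡Z w′Y′≡Z
      (ww′B≤Z w≤B w′≤B) (cross-+ {s} {r} {s′} {r′} sr′<s′r)
    left-lower : r′ * Y′ + B ≤ r * Y
    left-lower = scaled-gap {a = r′} {a′ = r} (weight-pos 1≤r′) (weight-pos 1≤r) w′Y′≡Z wY≡Z
      (ww′B≤Z w′≤B w≤B)
      (subst₂ _<_ (cong (r′ *_) (ℕₚ.+-comm s r)) (cong (r *_) (ℕₚ.+-comm s′ r′))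
        (cross-+ {r′} {s′} {r} {s} (subst₂ _<_ (ℕₚ.*-comm s r′) (ℕₚ.*-comm s′ r) sr′<s′r)))

  nested-blocks-properties : ∀ {D} → All Good D → AllPairs Steeper D →
    let A = nested (map blocks D) in Convex A × length D ≤ mirrors A A × length A ≤ suc (B * length D)
  nested-blocks-properties {D} goods steeper =
    nested-convex Z (map blocks D) (Allₚ.map⁺ (All.map blocks-straddle goods))
                  (AllPairsₚ.map⁺ (AllPairs-map-under blocks-inside goods steeper)) ,
    subst (_≤ mirrors (nested (map blocks D)) (nested (map blocks D))) (Listₚ.length-map blocks D)
          (nested-mirrors _ (Allₚ.map⁺ (All.map blocks-balanced goods))) ,
    subst (λ k → length (nested (map blocks D)) ≤ suc (B * k)) (Listₚ.length-map blocks D)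
          (length-nested-≤ B _ (Allₚ.map⁺ (All.map blocks-size goods)))

-- Reduced fractions are dense

-- Σ₂ f n = f 2 + f 3 + ⋯ + f (n + 1)
Σ₂ : (ℕ → ℕ) → ℕ → ℕ
Σ₂ f zero    = 0
Σ₂ f (suc n) = Σ₂ f n + f (2 + n)

Σ₂-+ : ∀ f g n → Σ₂ (λ d → f d + g d) n ≡ Σ₂ f n + Σ₂ g n
Σ₂-+ f g zero    = refl
Σ₂-+ f g (suc n) = trans (cong (_+ (f (2 + n) + g (2 + n))) (Σ₂-+ f g n))
                         (interchange (Σ₂ f n) (Σ₂ g n) (f (2 + n)) (g (2 + n)))
  where
  interchange : ∀ a b c d → (a + b) + (c + d) ≡ (a + c) + (b + d)
  interchange = solve-∀

term-≤-Σ₂ : ∀ f {d n} → 2 ≤ d → d ≤ suc n → f d ≤ Σ₂ f n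
term-≤-Σ₂ f {suc (suc i)} {suc n} (s≤s (s≤s _)) (s≤s (s≤s i≤n)) with ℕₚ.m≤n⇒m<n∨m≡n i≤n
... | inj₁ i<n  = ℕₚ.≤-trans (term-≤-Σ₂ f (s≤s (s≤s z≤n)) (s≤s i<n)) (ℕₚ.m≤m+n _ _)
... | inj₂ refl = ℕₚ.m≤n+m _ _

Σ₂-inverse-squares : ∀ {K} g → (∀ d → g d * (d * d) ≤ K) → ∀ n → 3 * Σ₂ g n ≤ 2 * K
Σ₂-inverse-squares {K} g gd²≤K n = ℕₚ.*-cancelˡ-≤ (3 + 2 * n) (begin
  (3 + 2 * n) * (3 * Σ₂ g n)         ≡⟨ rearrange n 3 (Σ₂ g n) ⟩
  3 * (3 + 2 * n) * Σ₂ g n           ≤⟨ ℕₚ.m≤m+n _ (6 * K) ⟩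
  3 * (3 + 2 * n) * Σ₂ g n + 6 * K   ≤⟨ telescope n ⟩
  2 * (3 + 2 * n) * K                ≡⟨ rearrange n 2 K ⟨
  (3 + 2 * n) * (2 * K)              ∎)
  where
  rearrange : ∀ n c x → (3 + 2 * n) * (c * x) ≡ c * (3 + 2 * n) * x
  rearrange = solve-∀
  -- 1/d² < 2 (1/(2d−1) − 1/(2d+1)), so the partial sums telescope below 2/3
  telescope : ∀ n → 3 * (3 + 2 * n) * Σ₂ g n + 6 * K ≤ 2 * (3 + 2 * n) * K
  telescope zero    = ℕₚ.≤-refl
  telescope (suc n) = ℕₚ.*-cancelˡ-≤ (3 + 2 * n) (begin
    (3 + 2 * n) * (3 * (3 + 2 * suc n) * (S + c) + 6 * K)
      ≡⟨ expand n S c K ⟩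
    (5 + 2 * n) * (3 * (3 + 2 * n) * S) + 3 * (c * ((3 + 2 * n) * (5 + 2 * n))) + (3 + 2 * n) * (6 * K)
      ≤⟨ ℕₚ.+-monoˡ-≤ ((3 + 2 * n) * (6 * K))
           (ℕₚ.+-monoʳ-≤ ((5 + 2 * n) * (3 * (3 + 2 * n) * S)) (ℕₚ.*-monoʳ-≤ 3 last-term)) ⟩
    (5 + 2 * n) * (3 * (3 + 2 * n) * S) + 3 * (4 * K) + (3 + 2 * n) * (6 * K)
      ≡⟨ collect n S K ⟩
    (5 + 2 * n) * (3 * (3 + 2 * n) * S + 6 * K)
      ≤⟨ ℕₚ.*-monoʳ-≤ (5 + 2 * n) (telescope n) ⟩
    (5 + 2 * n) * (2 * (3 + 2 * n) * K)
      ≡⟨ swap n K ⟩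
    (3 + 2 * n) * (2 * (3 + 2 * suc n) * K) ∎)
    where
    S c : ℕ
    S = Σ₂ g n
    c = g (2 + n)
    last-term : c * ((3 + 2 * n) * (5 + 2 * n)) ≤ 4 * K
    last-term = begin
      c * ((3 + 2 * n) * (5 + 2 * n))       ≤⟨ ℕₚ.m≤m+n _ c ⟩
      c * ((3 + 2 * n) * (5 + 2 * n)) + c   ≡⟨ square n c ⟩
      4 * (c * ((2 + n) * (2 + n)))         ≤⟨ ℕₚ.*-monoʳ-≤ 4 (gd²≤K (2 + n)) ⟩
      4 * K                                 ∎
      where
      square : ∀ n c → c * ((3 + 2 * n) * (5 + 2 * n)) + c ≡ 4 * (c * ((2 + n) * (2 + n)))
      square = solve-∀
    expand : ∀ n S c K → (3 + 2 * n) * (3 * (3 + 2 * suc n) * (S + c) + 6 * K)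
             ≡ (5 + 2 * n) * (3 * (3 + 2 * n) * S) + 3 * (c * ((3 + 2 * n) * (5 + 2 * n))) + (3 + 2 * n) * (6 * K)
    expand = solve-∀
    collect : ∀ n S K → (5 + 2 * n) * (3 * (3 + 2 * n) * S) + 3 * (4 * K) + (3 + 2 * n) * (6 * K)
              ≡ (5 + 2 * n) * (3 * (3 + 2 * n) * S + 6 * K)
    collect = solve-∀
    swap : ∀ n K → (5 + 2 * n) * (2 * (3 + 2 * n) * K) ≡ (3 + 2 * n) * (2 * (3 + 2 * suc n) * K)
    swap = solve-∀

Σ₂-cong : ∀ {f g} → (∀ d → f d ≡ g d) → ∀ n → Σ₂ f n ≡ Σ₂ g n
Σ₂-cong f≗g zero    = refl
Σ₂-cong f≗g (suc n) = cong₂ _+_ (Σ₂-cong f≗g n) (f≗g (2 + n))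

module _ {A : Set} {P : A → Set} {Q : ℕ → A → Set}
         (P? : Relation.Unary.Decidable P) (Q? : ∀ d → Relation.Unary.Decidable (Q d)) (n : ℕ) where

  private
    counts : List A → ℕ
    counts xs = Σ₂ (λ d → length (filter (Q? d) xs)) n

    counts-∷ : ∀ x xs → counts (x ∷ xs) ≡ counts (x ∷ []) + counts xs
    counts-∷ x xs = trans (Σ₂-cong (λ d → length-filter-++ (Q? d) (x ∷ []) xs) n) (Σ₂-+ _ _ n)

  covering-bound : ∀ xs → (∀ {x} → x ∈ xs → P x ⊎ ∃[ d ] (2 ≤ d × d ≤ suc n × Q d x)) →
                   length xs ≤ length (filter P? xs) + Σ₂ (λ d → length (filter (Q? d) xs)) n
  covering-bound []       _     = z≤n
  covering-bound (x ∷ xs) cover with P? x | cover (here refl)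
  ... | yes _  | _       = s≤s (ℕₚ.≤-trans (covering-bound xs (λ x∈xs → cover (there x∈xs)))
                                (ℕₚ.+-monoʳ-≤ _ (subst (counts xs ≤_) (sym (counts-∷ x xs)) (ℕₚ.m≤n+m _ _))))
  ... | no ¬px | inj₁ px = ⊥-elim (¬px px)
  ... | no _   | inj₂ (d , 2≤d , d≤1+n , Qdx) = begin
    suc (length xs)                                      ≤⟨ s≤s (covering-bound xs (λ x∈xs → cover (there x∈xs))) ⟩
    suc (length (filter P? xs) + counts xs)              ≡⟨ ℕₚ.+-suc _ (counts xs) ⟨
    length (filter P? xs) + suc (counts xs)              ≤⟨ ℕₚ.+-monoʳ-≤ _ (ℕₚ.+-monoˡ-≤ (counts xs) hit) ⟩
    length (filter P? xs) + (counts (x ∷ []) + counts xs) ≡⟨ cong (_+_ (length (filter P? xs))) (counts-∷ x xs) ⟨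
    length (filter P? xs) + counts (x ∷ xs)              ∎
    where
    hit : 1 ≤ counts (x ∷ [])
    hit = ℕₚ.≤-trans (Listₚ.filter-some (Q? d) (here Qdx))
                     (term-≤-Σ₂ (λ d → length (filter (Q? d) (x ∷ []))) 2≤d d≤1+n)

∣-<⇒+≤ : ∀ {d a b} → d ∣ a → d ∣ b → a < b → a + d ≤ b
∣-<⇒+≤ {d} (divides-refl i) (divides-refl j) id<jd =
  subst (_≤ j * d) (ℕₚ.+-comm d (i * d)) (ℕₚ.*-monoˡ-≤ d (ℕₚ.*-cancelʳ-< d i j id<jd))

multiples-spread : ∀ {d M} lo xs → d ∣ lo → lo ≤ M → AllPairs _<_ xs → All (lo <_) xs →
                   All (λ x → d ∣ x × x ≤ M) xs → lo + length xs * d ≤ M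
multiples-spread lo []       _    lo≤M _            _             _                      =
  subst (_≤ _) (sym (ℕₚ.+-identityʳ lo)) lo≤M
multiples-spread {d} lo (x ∷ xs) d∣lo _ (x<xs ∷ xs↗) (lo<x ∷ _) ((d∣x , x≤M) ∷ rest) = begin
  lo + (d + length xs * d) ≡⟨ ℕₚ.+-assoc lo d _ ⟨
  lo + d + length xs * d   ≤⟨ ℕₚ.+-monoˡ-≤ _ (∣-<⇒+≤ d∣lo d∣x lo<x) ⟩
  x + length xs * d        ≤⟨ multiples-spread x xs d∣x x≤M xs↗ x<xs rest ⟩
  _                        ∎

range : ℕ → List ℕ
range M = applyUpTo suc M

∈-range⁻ : ∀ {M x} → x ∈ range M → 1 ≤ x × x ≤ M
∈-range⁻ x∈ with ∈-applyUpTo⁻ suc x∈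
... | i , i<M , refl = s≤s z≤n , i<M

range-sorted : ∀ M → AllPairs _<_ (range M)
range-sorted M = AllPairsₚ.applyUpTo⁺₁ suc M (λ i<j _ → s≤s i<j)

multiples-in-range : ∀ d M → length (filter (d ∣?_) (range M)) * d ≤ M
multiples-in-range d M = multiples-spread 0 (filter (d ∣?_) (range M)) (divides-refl 0) z≤n
  (AllPairsₚ.filter⁺ (d ∣?_) (range-sorted M))
  (Allₚ.filter⁺ (d ∣?_) (All.tabulate {xs = range M} (λ x∈ → proj₁ (∈-range⁻ x∈))))
  (All.zip (Allₚ.all-filter (d ∣?_) (range M) ,
            Allₚ.filter⁺ (d ∣?_) (All.tabulate {xs = range M} (λ x∈ → proj₂ (∈-range⁻ x∈)))))

length-cartesianProduct : ∀ {A B : Set} (xs : List A) (ys : List B) →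
                          length (cartesianProduct xs ys) ≡ length xs * length ys
length-cartesianProduct []       ys = refl
length-cartesianProduct (x ∷ xs) ys = trans (Listₚ.length-++ (map (x ,_) ys))
  (cong₂ _+_ (Listₚ.length-map (x ,_) ys) (length-cartesianProduct xs ys))

module _ {A B : Set} {P : A → Set} {Q : B → Set}
         (P? : Relation.Unary.Decidable P) (Q? : Relation.Unary.Decidable Q) where

  private
    R? : Relation.Unary.Decidable (λ (z : A × B) → P (proj₁ z) × Q (proj₂ z))
    R? z = P? (proj₁ z) ×-dec Q? (proj₂ z)

    row-accepted : ∀ {x} → P x → ∀ ys → length (filter R? (map (x ,_) ys)) ≡ length (filter Q? ys)
    row-accepted px []       = refl
    row-accepted {x} px (y ∷ ys) with P? x | Q? y
    ... | yes _  | yes _ = cong suc (row-accepted px ys)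
    ... | yes _  | no _  = row-accepted px ys
    ... | no ¬px | _     = ⊥-elim (¬px px)

    row-rejected : ∀ {x} → ¬ P x → ∀ ys → length (filter R? (map (x ,_) ys)) ≡ 0
    row-rejected ¬px ys = cong length (Listₚ.filter-none R? (Allₚ.map⁺ (All.universal (λ _ r → ¬px (proj₁ r)) ys)))

  length-filter-cartesianProduct : ∀ xs ys →
    length (filter (λ z → P? (proj₁ z) ×-dec Q? (proj₂ z)) (cartesianProduct xs ys)) ≡
    length (filter P? xs) * length (filter Q? ys)
  length-filter-cartesianProduct []       ys = refl
  length-filter-cartesianProduct (x ∷ xs) ys with P? x
  ... | yes px = trans (length-filter-++ R? (map (x ,_) ys) _)
                       (cong₂ _+_ (row-accepted px ys) (length-filter-cartesianProduct xs ys))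
  ... | no ¬px = trans (length-filter-++ R? (map (x ,_) ys) _)
                       (cong₂ _+_ (row-rejected ¬px ys) (length-filter-cartesianProduct xs ys))

coprime-or-common-divisor : ∀ {p q M} → 1 ≤ p → p ≤ M →
                            Coprime p q ⊎ ∃[ d ] (2 ≤ d × d ≤ suc M × (d ∣ p × d ∣ q))
coprime-or-common-divisor {p} {q} 1≤p p≤M with gcd p q in g≡
... | 0           = ⊥-elim (ℕₚ.<⇒≢ 1≤p (sym (gcd[m,n]≡0⇒m≡0 g≡)))
... | 1           = inj₁ (gcd≡1⇒coprime g≡)
... | suc (suc i) = inj₂ (2 + i , s≤s (s≤s z≤n) ,
                          ℕₚ.m≤n⇒m≤1+n (ℕₚ.≤-trans (∣⇒≤ {{>-nonZero 1≤p}} g∣p) p≤M) , g∣p , g∣q)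
  where
  g∣p : 2 + i ∣ p
  g∣p = subst (_∣ p) g≡ (gcd[m,n]∣m p q)
  g∣q : 2 + i ∣ q
  g∣q = subst (_∣ q) g≡ (gcd[m,n]∣n p q)

pairs : ℕ → List (ℕ × ℕ)
pairs M = cartesianProduct (range M) (range M)

reducedPairs : ℕ → List (ℕ × ℕ)
reducedPairs M = filter (λ x → coprime? (proj₁ x) (proj₂ x)) (pairs M)

length-reducedPairs-≥ : ∀ M → M * M ≤ 3 * length (reducedPairs M)
length-reducedPairs-≥ M = ℕₚ.+-cancelʳ-≤ (2 * (M * M)) (M * M) (3 * C) (begin
  M * M + 2 * (M * M)          ≡⟨ three (M * M) ⟩
  3 * (M * M)                  ≡⟨ cong (3 *_) length-pairs ⟨
  3 * length (pairs M)         ≤⟨ ℕₚ.*-monoʳ-≤ 3 covered ⟩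
  3 * (C + Σ₂ common M)        ≡⟨ ℕₚ.*-distribˡ-+ 3 C (Σ₂ common M) ⟩
  3 * C + 3 * Σ₂ common M      ≤⟨ ℕₚ.+-monoʳ-≤ (3 * C) (Σ₂-inverse-squares common common-bound M) ⟩
  3 * C + 2 * (M * M)          ∎)
  where
  C : ℕ
  C = length (reducedPairs M)
  common : ℕ → ℕ
  common d = length (filter (λ z → (d ∣? proj₁ z) ×-dec (d ∣? proj₂ z)) (pairs M))
  three : ∀ K → K + 2 * K ≡ 3 * K
  three = solve-∀
  length-pairs : length (pairs M) ≡ M * M
  length-pairs = trans (length-cartesianProduct (range M) (range M))
                       (cong₂ _*_ (Listₚ.length-applyUpTo suc M) (Listₚ.length-applyUpTo suc M))
  covered : length (pairs M) ≤ C + Σ₂ common M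
  covered = covering-bound (λ x → coprime? (proj₁ x) (proj₂ x)) (λ d z → (d ∣? proj₁ z) ×-dec (d ∣? proj₂ z))
    M (pairs M) (λ z∈ → let 1≤p , p≤M = ∈-range⁻ (proj₁ (∈-cartesianProduct⁻ (range M) (range M) z∈))
                        in coprime-or-common-divisor 1≤p p≤M)
  common-bound : ∀ d → common d * (d * d) ≤ M * M
  common-bound d = begin
    common d * (d * d)
      ≡⟨ cong (_* (d * d)) (length-filter-cartesianProduct (d ∣?_) (d ∣?_) (range M) (range M)) ⟩
    m * m * (d * d)    ≡⟨ regroup m d ⟩
    (m * d) * (m * d)  ≤⟨ ℕₚ.*-mono-≤ (multiples-in-range d M) (multiples-in-range d M) ⟩
    M * M              ∎
    where
    m : ℕ
    m = length (filter (d ∣?_) (range M))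
    regroup : ∀ m d → m * m * (d * d) ≡ (m * d) * (m * d)
    regroup = solve-∀

-- Ordering reduced fractions by slope

-- the value at a zero denominator is junk: `Reduced` pairs never have one
fraction : ℕ × ℕ → ℚ
fraction (p , zero)    = 0ℚ
fraction (p , suc d-1) = normalize p (suc d-1)

Reduced : ℕ → ℕ × ℕ → Set
Reduced M (p , d) = (1 ≤ p × p ≤ M) × (1 ≤ d × d ≤ M) × Coprime p d

∈-reducedPairs⁻ : ∀ {M x} → x ∈ reducedPairs M → Reduced M x
∈-reducedPairs⁻ {M} x∈ with ∈-filter⁻ (λ x → coprime? (proj₁ x) (proj₂ x)) x∈
... | x∈pairs , coprime with ∈-cartesianProduct⁻ (range M) (range M) x∈pairs
... | p∈ , d∈ = ∈-range⁻ p∈ , ∈-range⁻ d∈ , coprime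

reducedPairs-unique : ∀ M → Unique (reducedPairs M)
reducedPairs-unique M = Uniqueₚ.filter⁺ (λ x → coprime? (proj₁ x) (proj₂ x))
  (Uniqueₚ.cartesianProduct⁺ range-unique range-unique)
  where
  range-unique : Unique (range M)
  range-unique = AllPairs.map ℕₚ.<⇒≢ (range-sorted M)

fraction-injective : ∀ {M x y} → Reduced M x → Reduced M y → fraction x ≡ fraction y → x ≡ y
fraction-injective {x = p , suc e} {p′ , suc e′} (_ , _ , c) (_ , _ , c′) eq =
  cong₂ _,_ (ℤₚ.+-injective (cong ℚ.numerator reduced-eq)) (cong suc (cong ℚ.denominator-1 reduced-eq))
  where
  reduced-eq : mkℚ (+ p) e _ ≡ mkℚ (+ p′) e′ _
  reduced-eq = trans (sym (ℚₚ.normalize-coprime c)) (trans eq (ℚₚ.normalize-coprime c′))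

fraction-<⇒cross : ∀ {M x y} → Reduced M x → Reduced M y → fraction x ℚ.< fraction y →
                   proj₁ x * proj₂ y < proj₁ y * proj₂ x
fraction-<⇒cross {x = p , suc e} {p′ , suc e′} (_ , _ , c) (_ , _ , c′) lt =
  ℤₚ.drop‿+<+ (subst₂ ℤ._<_ (sym (ℤₚ.pos-* p (suc e′))) (sym (ℤₚ.pos-* p′ (suc e)))
    (ℚₚ.drop-*<* (subst₂ ℚ._<_ (ℚₚ.normalize-coprime c) (ℚₚ.normalize-coprime c′) lt)))

≤∧≢⇒< : ∀ {p q} → p ℚ.≤ q → p ≢ q → p ℚ.< q
≤∧≢⇒< {p} {q} p≤q p≢q with ℚₚ.<-cmp p q
... | tri< p<q _ _ = p<q
... | tri≈ _ p≡q _ = ⊥-elim (p≢q p≡q)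
... | tri> _ _ q<p = ⊥-elim (ℚₚ.<-irrefl refl (ℚₚ.≤-<-trans p≤q q<p))

open import Data.List.Sort (On.decTotalOrder ℚₚ.≤-decTotalOrder fraction) using (sort; sort-↭; sort-↗)

reducedBySlope : ℕ → List (ℕ × ℕ)
reducedBySlope M = sort (reducedPairs M)

length-reducedBySlope : ∀ M → length (reducedBySlope M) ≡ length (reducedPairs M)
length-reducedBySlope M = ↭-length (sort-↭ (reducedPairs M))

reducedBySlope-reduced : ∀ M → All (Reduced M) (reducedBySlope M)
reducedBySlope-reduced M = All-resp-↭ (↭-sym (sort-↭ (reducedPairs M))) (All.tabulate ∈-reducedPairs⁻)

reducedBySlope-increasing : ∀ M → AllPairs (λ x y → proj₁ x * proj₂ y < proj₁ y * proj₂ x) (reducedBySlope M)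
reducedBySlope-increasing M = AllPairs-map-under
  (λ rx ry (x≤y , x≢y) → fraction-<⇒cross rx ry (≤∧≢⇒< x≤y (λ eq → x≢y (fraction-injective rx ry eq))))
  (reducedBySlope-reduced M)
  (AllPairs.zip (Linkedₚ.Linked⇒AllPairs ℚₚ.≤-trans (sort-↗ (reducedPairs M)) , distinct))
  where
  distinct : Unique (reducedBySlope M)
  distinct = Permutationₛ.Unique-resp-↭ (setoid _) (↭⇒↭ₛ (↭-sym (sort-↭ (reducedPairs M))))
                                        (reducedPairs-unique M)

∣-factorial : ∀ {w n} → 1 ≤ w → w ≤ n → w ∣ n !
∣-factorial {suc k} _ w≤n = ∣-trans (m∣m*n (k !)) (m≤n⇒m!∣n! w≤n)

-- Z = B! · B³ is divisible by every weight r + s ≤ B.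
bound scale : ℕ → ℕ
bound M = 3 * M
scale M = bound M ! * (bound M * bound M * bound M)

bound³≤scale : ∀ M → bound M * bound M * bound M ≤ scale M
bound³≤scale M = ℕₚ.m≤n*m _ (bound M !) {{>-nonZero (ℕₚ.1≤n! (bound M))}}

-- s/r = 1 + p/d grows with the fraction p/d; a zero denominator gives junk, as for `fraction`.
direction : ℕ → ℕ × ℕ → Direction
direction M (p , zero)      = 0 , 0 , 0
direction M (p , d@(suc _)) = p + d , d , scale M / (d + (p + d))

module _ (M : ℕ) where
  open Directions (bound M) (scale M) (bound³≤scale M)

  direction-good : ∀ {x} → Reduced M x → Good (direction M x)
  direction-good {p , d@(suc _)} ((1≤p , p≤M) , (_ , d≤M) , _) =
    s≤s z≤n , ℕₚ.m<n+m d 1≤p , weight≤bound ,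
    m*[n/m]≡n (∣-trans (∣-factorial (s≤s z≤n) weight≤bound) (m∣m*n _))
    where
    weight≤bound : d + (p + d) ≤ bound M
    weight≤bound = ℕₚ.≤-trans (ℕₚ.+-mono-≤ d≤M (ℕₚ.+-mono-≤ p≤M d≤M)) (ℕₚ.≤-reflexive (thrice M))
      where
      thrice : ∀ M → M + (M + M) ≡ 3 * M
      thrice = solve-∀

  direction-steeper : ∀ {x y} → Reduced M x → Reduced M y →
                      proj₁ x * proj₂ y < proj₁ y * proj₂ x → Steeper (direction M x) (direction M y)
  direction-steeper {p , d@(suc _)} {p′ , d′@(suc _)} _ _ pd′<p′d = begin-strict
    (p + d) * d′       ≡⟨ ℕₚ.*-distribʳ-+ d′ p d ⟩
    p * d′ + d * d′    <⟨ ℕₚ.+-monoˡ-< (d * d′) pd′<p′d ⟩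
    p′ * d + d * d′    ≡⟨ regroup p′ d d′ ⟩
    (p′ + d′) * d      ∎
    where
    regroup : ∀ p′ d d′ → p′ * d + d * d′ ≡ (p′ + d′) * d
    regroup = solve-∀

  directions : List Direction
  directions = map (direction M) (reducedBySlope M)

  convexSet : List ℤ
  convexSet = nested (map blocks directions)

  convexSet-properties : Convex convexSet × length (reducedPairs M) ≤ mirrors convexSet convexSet ×
                         length convexSet ≤ suc (bound M * length (reducedPairs M))
  convexSet-properties
    rewrite sym (length-reducedBySlope M) | sym (Listₚ.length-map (direction M) (reducedBySlope M)) =
    nested-blocks-properties
      (Allₚ.map⁺ (All.map direction-good (reducedBySlope-reduced M)))
      (AllPairsₚ.map⁺ (AllPairs-map-under direction-steeper (reducedBySlope-reduced M)
                                                            (reducedBySlope-increasing M)))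

size-vs-centre-count : ∀ {M k a L} → 1 ≤ M → M * M ≤ 3 * k → k ≤ a → L ≤ suc (3 * M * k) → L ^ 2 ≤ 48 * a ^ 3
size-vs-centre-count {M} {k} {a} {L} 1≤M M²≤3k k≤a L≤ = begin
  L ^ 2                      ≤⟨ ℕₚ.^-monoˡ-≤ 2 L≤4Mk ⟩
  (4 * (M * k)) ^ 2          ≡⟨ square M k ⟩
  16 * (M * M) * (k * k)     ≤⟨ ℕₚ.*-monoˡ-≤ (k * k) (ℕₚ.*-monoʳ-≤ 16 M²≤3k) ⟩
  16 * (3 * k) * (k * k)     ≡⟨ cube k ⟩
  48 * k ^ 3                 ≤⟨ ℕₚ.*-monoʳ-≤ 48 (ℕₚ.^-monoˡ-≤ 3 k≤a) ⟩
  48 * a ^ 3                 ∎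
  where
  square : ∀ M k → 4 * (M * k) * (4 * (M * k) * 1) ≡ 16 * (M * M) * (k * k)
  square = solve-∀
  cube : ∀ k → 16 * (3 * k) * (k * k) ≡ 48 * (k * (k * (k * 1)))
  cube = solve-∀
  1≤k : 1 ≤ k
  1≤k = ℕₚ.*-cancelˡ-< 3 0 k (ℕₚ.≤-trans (ℕₚ.*-mono-≤ 1≤M 1≤M) M²≤3k)
  L≤4Mk : L ≤ 4 * (M * k)
  L≤4Mk = begin
    L                   ≤⟨ L≤ ⟩
    1 + 3 * M * k       ≤⟨ ℕₚ.+-monoˡ-≤ (3 * M * k) (ℕₚ.*-mono-≤ 1≤M 1≤k) ⟩
    M * k + 3 * M * k   ≡⟨ four M k ⟩
    4 * (M * k)         ∎
    where
    four : ∀ M k → M * k + 3 * M * k ≡ 4 * (M * k)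
    four = solve-∀

N<length-reducedPairs : ∀ N → N < length (reducedPairs (suc (3 * N)))
N<length-reducedPairs N = ℕₚ.*-cancelˡ-< 3 N _ (begin
  suc (3 * N)                  ≤⟨ ℕₚ.m≤m*n (suc (3 * N)) (suc (3 * N)) ⟩
  suc (3 * N) * suc (3 * N)    ≤⟨ length-reducedPairs-≥ (suc (3 * N)) ⟩
  3 * length (reducedPairs (suc (3 * N))) ∎)

theorem3p7 : ∃[ k ] (1 ≤ k × ((N : ℕ) → ∃[ A ] (Convex A × N ≤ length A ×
               ∃[ x ] (x ∈ A × length A ^ 2 ≤ k * apCount A x ^ 3))))
theorem3p7 = 48 , s≤s z≤n , λ N →
  let M = suc (3 * N)
      convex , k≤mirrors , size≤ = convexSet-properties M
  in convexSet M , convex ,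
     ℕₚ.≤-trans (ℕₚ.<⇒≤ (N<length-reducedPairs N)) (ℕₚ.≤-trans k≤mirrors (Listₚ.length-filter _ (convexSet M))) ,
     + 0 , 0∈nested (map blocks (directions M)) ,
     size-vs-centre-count {M = M} (s≤s z≤n) (length-reducedPairs-≥ M)
       (ℕₚ.≤-trans k≤mirrors (mirrors-≤-apCount (convexSet M))) size≤
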